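{- Let $(G,A)$ be a simple edge-weighted graph, let $v$ be a vertex of $G$, and let $(G',A')$ be the result of the star-clique operation on $v$. Let $w,u$ be distinct vertices of $G$, both different from $v$. Let $\mathcal{P}$ be the set of paths from $w$ to $u$ in $G$ and $\mathcal{Q}$ the set of paths from $w$ to $u$ in $G'$. Then $[\mathcal{P}]=[\mathcal{Q}]$.
   Context: An edge-weighted graph $(G,A)$ is a finite loopless graph (multiple edges allowed unless "simple" is stated) with a weight function $A$ from its edges to positive integers. Star-clique on a vertex $v$ of a simple graph with neighbours $x_1,\dots,x_d$ and edge $vx_k$ of weight $a_k$: delete $v$ and its incident edges and, for each pair $j<k$, add a new edge between $x_j$ and $x_k$ of weight $\gcd(a_j,a_k)$ (possibly creating multiple edges); all other vertices and edges are unchanged. A path from $w$ to $u$ is a sequence of distinct vertices $w=y_0,\dots,y_k=u$ together with a choice, for each $t$, of an edge joining $y_{t-1}$ and $y_t$. For a path $p$, $(p)$ denotes the gcd of the weights of its edges; for a set $\mathcal{P}$ of paths, $[\mathcal{P}]$ denotes the lcm of the numbers $(p)$, $p\in\mathcal{P}$. -}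

module Defs where

open import Data.Nat using (ℕ; zero; suc; _<_)
open import Data.Nat.GCD using (gcd)
open import Data.Nat.Divisibility using (_∣_)
open import Data.Fin using (Fin; zero; suc; punchOut; fromℕ; inject₁; _≟_)
open import Data.List using (List; []; _∷_; _++_; map; mapMaybe; length; lookup)
open import Data.List.Relation.Unary.All using (All)
open import Data.Maybe using (Maybe; just; nothing)
open import Data.Product using (_×_; _,_)
open import Data.Sum using (_⊎_)
open import Relation.Binary.PropositionalEquality using (_≡_; _≢_)
open import Relation.Nullary using (¬_; yes; no)
open import Function.Definitions using (Injective)

record Edge (n : ℕ) : Set where
  constructor edge
  field
    end₁ end₂ : Fin n
    weight    : ℕ
open Edge public

-- An edge-weighted (multi)graph on Fin n: a finite list of edges
-- (each list position is a distinct edge; parallel edges allowed).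
Graph : ℕ → Set
Graph n = List (Edge n)

Loopless : ∀ {n} → Graph n → Set
Loopless E = All (λ e → end₁ e ≢ end₂ e) E

PositiveWeights : ∀ {n} → Graph n → Set
PositiveWeights E = All (λ e → 0 < weight e) E

Joins : ∀ {n} → Edge n → Fin n → Fin n → Set
Joins e a b = (end₁ e ≡ a × end₂ e ≡ b) ⊎ (end₁ e ≡ b × end₂ e ≡ a)

Simple : ∀ {n} → Graph n → Set
Simple E = ∀ (i j : Fin (length E)) → i ≢ j →
  ¬ Joins (lookup E j) (end₁ (lookup E i)) (end₂ (lookup E i))

del : ∀ {n} → Fin (suc n) → Fin (suc n) → Maybe (Fin n)
del v x with v ≟ x
... | yes _ = nothing
... | no v≢x = just (punchOut v≢x)

keepEdge : ∀ {n} → Fin (suc n) → Edge (suc n) → Maybe (Edge n)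
keepEdge v (edge a b c) with del v a | del v b
... | just a' | just b' = just (edge a' b' c)
... | _ | _ = nothing

incident : ∀ {n} → Fin (suc n) → Edge (suc n) → Maybe (Fin (suc n) × ℕ)
incident v (edge a b c) with a ≟ v | b ≟ v
... | yes _ | _ = just (b , c)
... | no _ | yes _ = just (a , c)
... | no _ | no _ = nothing

pairs : ∀ {A : Set} → List A → List (A × A)
pairs [] = []
pairs (x ∷ xs) = map (λ y → (x , y)) xs ++ pairs xs

cliqueEdge : ∀ {n} → Fin (suc n) → (Fin (suc n) × ℕ) × (Fin (suc n) × ℕ) → Maybe (Edge n)
cliqueEdge v ((x , a) , (y , b)) with del v x | del v y
... | just x' | just y' = just (edge x' y' (gcd a b))
... | _ | _ = nothing

starClique : ∀ {n} → Fin (suc n) → Graph (suc n) → Graph n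
starClique v E =
  mapMaybe (keepEdge v) E ++ mapMaybe (cliqueEdge v) (pairs (mapMaybe (incident v) E))

record Path {n : ℕ} (E : Graph n) (w u : Fin n) : Set where
  field
    len    : ℕ
    vert   : Fin (suc len) → Fin n
    inj    : Injective _≡_ _≡_ vert
    start  : vert zero ≡ w
    finish : vert (fromℕ len) ≡ u
    edges  : (t : Fin len) → Fin (length E)
    joins  : (t : Fin len) → Joins (lookup E (edges t)) (vert (inject₁ t)) (vert (suc t))
open Path public

-- gcd of finitely many numbers (gcd of the empty family is 0).
gcdF : (k : ℕ) → (Fin k → ℕ) → ℕ
gcdF zero f = 0
gcdF (suc k) f = gcd (f zero) (gcdF k (λ t → f (suc t)))

pathGcd : ∀ {n} {E : Graph n} {w u : Fin n} → Path E w u → ℕ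
pathGcd {E = E} p = gcdF (len p) (λ t → weight (lookup E (edges p t)))

-- m is [P], the lcm of the numbers (p) over the set P of all paths w → u
-- (universal property of the lcm w.r.t. divisibility).
IsPathLcm : ∀ {n} → Graph n → Fin n → Fin n → ℕ → Set
IsPathLcm E w u m =
  (∀ (p : Path E w u) → pathGcd p ∣ m) ×
  (∀ (d : ℕ) → (∀ (p : Path E w u) → pathGcd p ∣ d) → m ∣ d)

-- Both sides are characterised by divisibility, so it suffices to dominate every path of
-- one graph by a path of the other: (p) ∣ (q).  A passage x → v → y through v is replaced
-- by the clique edge x – y, whose weight gcd(a, b) is divisible by (p); conversely a clique
-- edge x – y of weight gcd(a, b) expands to x → v → y, whose weights a and b are multiples
-- of it.  The resulting walks may repeat vertices (v, in the second direction), but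
-- shortcutting a walk to a path only deletes edges, which can only enlarge the gcd.

module Submission where

open import Level using (Level; 0ℓ)
open import Data.Nat using (ℕ; zero; suc)
open import Data.Nat.GCD using (gcd; gcd[m,n]∣m; gcd[m,n]∣n; gcd-greatest)
open import Data.Nat.Divisibility using (_∣_; ∣-trans; _∣0)
open import Data.Fin using (Fin; zero; suc; punchOut; punchIn; fromℕ; inject₁; _≟_)
open import Data.Fin.Properties using (punchOut-cong; punchIn-punchOut)
open import Data.List using (List; []; _∷_; _++_; map; mapMaybe; length; lookup)
open import Data.List.Membership.Propositional using (_∈_)
open import Data.List.Membership.Propositional.Properties using (∈-lookup; ∈-++⁺ˡ; ∈-++⁺ʳ; ∈-++⁻; ∈-map⁺; ∈-map⁻)
import Data.List.Membership.DecPropositional as DecMembership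
open import Data.List.Relation.Unary.All as All using ([])
open import Data.List.Relation.Unary.All.Properties using (¬Any⇒All¬)
open import Data.List.Relation.Unary.Any using (here; there; index)
open import Data.List.Relation.Unary.Any.Properties using (lookup-index)
open import Data.List.Relation.Unary.Unique.Propositional using (Unique; []; _∷_; tail)
open import Data.Maybe using (Maybe; just; nothing)
open import Data.Product as Product using (Σ-syntax; _×_; _,_; proj₁; proj₂; map₂)
open import Data.Sum as Sum using (_⊎_; inj₁; inj₂)
open import Data.Empty using (⊥-elim)
open import Function using (_∘_; _$_; id)
open import Function.Definitions using (Injective)
open import Relation.Binary.Core using (Rel)
open import Relation.Binary.Definitions using (Symmetric; DecidableEquality)
open import Relation.Binary.Construct.Closure.ReflexiveTransitive using (Star; ε; _◅_; _◅◅_; kleisliStar)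
open import Relation.Binary.PropositionalEquality
open import Relation.Nullary using (yes; no)

open import Defs

gcdF-greatest : ∀ {d} k (f : Fin k → ℕ) → (∀ t → d ∣ f t) → d ∣ gcdF k f
gcdF-greatest zero    f d∣f = _ ∣0
gcdF-greatest (suc k) f d∣f = gcd-greatest (d∣f zero) (gcdF-greatest k (f ∘ suc) (d∣f ∘ suc))

gcdF∣ : ∀ k (f : Fin k → ℕ) (t : Fin k) → gcdF k f ∣ f t
gcdF∣ (suc k) f zero    = gcd[m,n]∣m _ _
gcdF∣ (suc k) f (suc t) = ∣-trans (gcd[m,n]∣n (f zero) _) (gcdF∣ k (f ∘ suc) t)

module _ {a ℓ : Level} {X : Set a} {R : Rel X ℓ} where

  walkLength : ∀ {x y} → Star R x y → ℕ
  walkLength ε       = zero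
  walkLength (_ ◅ s) = suc (walkLength s)

  vertices : ∀ {x y} → Star R x y → List X
  vertices {x} ε       = x ∷ []
  vertices {x} (_ ◅ s) = x ∷ vertices s

  vertexAt : ∀ {x y} (p : Star R x y) → Fin (suc (walkLength p)) → X
  vertexAt {x} _   zero    = x
  vertexAt (_ ◅ s) (suc t) = vertexAt s t

  vertexAt-last : ∀ {x y} (p : Star R x y) → vertexAt p (fromℕ (walkLength p)) ≡ y
  vertexAt-last ε       = refl
  vertexAt-last (_ ◅ s) = vertexAt-last s

  vertexAt∈vertices : ∀ {x y} (p : Star R x y) t → vertexAt p t ∈ vertices p
  vertexAt∈vertices ε       zero    = here refl
  vertexAt∈vertices (_ ◅ s) zero    = here refl
  vertexAt∈vertices (_ ◅ s) (suc t) = there (vertexAt∈vertices s t)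

  vertexAt-injective : ∀ {x y} (p : Star R x y) → Unique (vertices p) → Injective _≡_ _≡_ (vertexAt p)
  vertexAt-injective ε       _          {zero}  {zero}  _  = refl
  vertexAt-injective (_ ◅ s) _          {zero}  {zero}  _  = refl
  vertexAt-injective (_ ◅ s) (x∉ ∷ _)   {zero}  {suc j} eq = ⊥-elim (All.lookup x∉ (vertexAt∈vertices s j) eq)
  vertexAt-injective (_ ◅ s) (x∉ ∷ _)   {suc i} {zero}  eq = ⊥-elim (All.lookup x∉ (vertexAt∈vertices s i) (sym eq))
  vertexAt-injective (_ ◅ s) (_ ∷ uniq) {suc i} {suc j} eq = cong suc (vertexAt-injective s uniq eq)

  stepAt : ∀ {x y} (p : Star R x y) (t : Fin (walkLength p)) → R (vertexAt p (inject₁ t)) (vertexAt p (suc t))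
  stepAt (r ◅ ε)       zero    = r
  stepAt (r ◅ (_ ◅ _)) zero    = r
  stepAt (_ ◅ s)       (suc t) = stepAt s t

  tabulateWalk : ∀ k (f : Fin (suc k) → X) → (∀ t → R (f (inject₁ t)) (f (suc t))) → Star R (f zero) (f (fromℕ k))
  tabulateWalk zero    f step = ε
  tabulateWalk (suc k) f step = step zero ◅ tabulateWalk k (f ∘ suc) (step ∘ suc)

  module _ (_≟ₓ_ : DecidableEquality X) where
    open DecMembership _≟ₓ_ using (_∈?_)

    dropUntil : ∀ {x y z} (p : Star R x y) → z ∈ vertices p →
      Σ[ q ∈ Star R z y ] (Unique (vertices p) → Unique (vertices q))
    dropUntil ε       (here refl) = ε , id
    dropUntil (r ◅ s) (here refl) = r ◅ s , id
    dropUntil (_ ◅ s) (there z∈)  = map₂ (_∘ tail) (dropUntil s z∈)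

    shortcut : ∀ {x y} → Star R x y → Σ[ q ∈ Star R x y ] Unique (vertices q)
    shortcut ε = ε , [] ∷ []
    shortcut {x} (r ◅ s) with shortcut s
    ... | q , uq with x ∈? vertices q
    ...   | yes x∈ = map₂ (_$ uq) (dropUntil q x∈)
    ...   | no x∉  = r ◅ q , ¬Any⇒All¬ _ x∉ ∷ uq

Joins-sym : ∀ {n} {e : Edge n} {x y} → Joins e x y → Joins e y x
Joins-sym = Sum.swap

Joins-elim : ∀ {n ℓ} {P : Rel (Fin n) ℓ} {e : Edge n} {x y} → Symmetric P →
  P (end₁ e) (end₂ e) → Joins e x y → P x y
Joins-elim _   p (inj₁ (refl , refl)) = p
Joins-elim sym p (inj₂ (refl , refl)) = sym p

DivEdge : ∀ {n} → Graph n → ℕ → Rel (Fin n) 0ℓ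
DivEdge {n} E d x y = Σ[ e ∈ Edge n ] e ∈ E × Joins e x y × d ∣ weight e

DivEdge-sym : ∀ {n} {E : Graph n} {d : ℕ} → Symmetric (DivEdge E d)
DivEdge-sym (e , e∈ , j , d∣) = e , e∈ , Joins-sym {e = e} j , d∣

module _ {n} {E : Graph n} where

  path⇒walk : ∀ {w u} (p : Path E w u) → Star (DivEdge E (pathGcd p)) w u
  path⇒walk p = subst₂ (Star _) (start p) (finish p) (tabulateWalk (len p) (vert p) step)
    where
    step : ∀ t → DivEdge E (pathGcd p) (vert p (inject₁ t)) (vert p (suc t))
    step t = lookup E (edges p t) , ∈-lookup _ , joins p t ,
             gcdF∣ (len p) (λ s → weight (lookup E (edges p s))) t

  simpleWalk⇒path : ∀ {d w u} (q : Star (DivEdge E d) w u) → Unique (vertices q) →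
    Σ[ p ∈ Path E w u ] d ∣ pathGcd p
  simpleWalk⇒path {d} q uniq = p , gcdF-greatest (walkLength q) _ d∣weights
    where
    edgeIndex : Fin (walkLength q) → Fin (length E)
    edgeIndex t = index (proj₁ (proj₂ (stepAt q t)))
    edgeAt : ∀ t → proj₁ (stepAt q t) ≡ lookup E (edgeIndex t)
    edgeAt t = lookup-index (proj₁ (proj₂ (stepAt q t)))
    d∣weights : ∀ t → d ∣ weight (lookup E (edgeIndex t))
    d∣weights t = subst (λ e → d ∣ weight e) (edgeAt t) (proj₂ (proj₂ (proj₂ (stepAt q t))))
    p : Path E _ _
    len p    = walkLength q
    vert p   = vertexAt q
    inj p    = vertexAt-injective q uniq
    start p  = refl
    finish p = vertexAt-last q
    edges p  = edgeIndex
    joins p t = subst (λ e → Joins e (vertexAt q (inject₁ t)) (vertexAt q (suc t))) (edgeAt t) (proj₁ (proj₂ (proj₂ (stepAt q t))))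

  walk⇒path : ∀ {d w u} → Star (DivEdge E d) w u → Σ[ p ∈ Path E w u ] d ∣ pathGcd p
  walk⇒path q = let q′ , uniq = shortcut _≟_ q in simpleWalk⇒path q′ uniq

IsPathLcm-transfer : ∀ {n₁ n₂} {E₁ : Graph n₁} {E₂ : Graph n₂} {w₁ u₁ w₂ u₂ m} →
  (∀ (p : Path E₁ w₁ u₁) → Σ[ q ∈ Path E₂ w₂ u₂ ] pathGcd p ∣ pathGcd q) →
  (∀ (q : Path E₂ w₂ u₂) → Σ[ p ∈ Path E₁ w₁ u₁ ] pathGcd q ∣ pathGcd p) →
  IsPathLcm E₁ w₁ u₁ m → IsPathLcm E₂ w₂ u₂ m
IsPathLcm-transfer to from (divides , least) =
  (λ q → let p , q∣p = from q in ∣-trans q∣p (divides p)) ,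
  (λ d paths∣d → least d λ p → let q , p∣q = to p in ∣-trans p∣q (paths∣d q))

module _ {A B : Set} (f : A → Maybe B) where

  ∈-mapMaybe⁺ : ∀ {x y} {xs : List A} → x ∈ xs → f x ≡ just y → y ∈ mapMaybe f xs
  ∈-mapMaybe⁺ {xs = x ∷ xs} (here refl) fx≡y with f x
  ∈-mapMaybe⁺ {xs = x ∷ xs} (here refl) refl | just _ = here refl
  ∈-mapMaybe⁺ {xs = x ∷ xs} (there x∈)  fx≡y with f x
  ... | just _  = there (∈-mapMaybe⁺ x∈ fx≡y)
  ... | nothing = ∈-mapMaybe⁺ x∈ fx≡y

  ∈-mapMaybe⁻ : ∀ {y} (xs : List A) → y ∈ mapMaybe f xs → Σ[ x ∈ A ] x ∈ xs × f x ≡ just y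
  ∈-mapMaybe⁻ (x ∷ xs) y∈ with f x in fx≡
  ∈-mapMaybe⁻ (x ∷ xs) (here refl) | just _ = x , here refl , fx≡
  ∈-mapMaybe⁻ (x ∷ xs) (there y∈)  | just _ = map₂ (Product.map₁ there) (∈-mapMaybe⁻ xs y∈)
  ∈-mapMaybe⁻ (x ∷ xs) y∈          | nothing = map₂ (Product.map₁ there) (∈-mapMaybe⁻ xs y∈)

module _ {A : Set} where

  ∈-pairs⁺ : ∀ {x y} {xs : List A} → x ∈ xs → y ∈ xs → x ≢ y → (x , y) ∈ pairs xs ⊎ (y , x) ∈ pairs xs
  ∈-pairs⁺ (here refl) (here refl) x≢y = ⊥-elim (x≢y refl)
  ∈-pairs⁺ (here refl) (there y∈)  _   = inj₁ (∈-++⁺ˡ (∈-map⁺ _ y∈))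
  ∈-pairs⁺ (there x∈)  (here refl) _   = inj₂ (∈-++⁺ˡ (∈-map⁺ _ x∈))
  ∈-pairs⁺ {xs = z ∷ xs} (there x∈) (there y∈) x≢y =
    Sum.map (∈-++⁺ʳ (map (z ,_) xs)) (∈-++⁺ʳ (map (z ,_) xs)) (∈-pairs⁺ x∈ y∈ x≢y)

  ∈-pairs⁻ : ∀ {x y} (xs : List A) → (x , y) ∈ pairs xs → x ∈ xs × y ∈ xs
  ∈-pairs⁻ (z ∷ xs) xy∈ with ∈-++⁻ (map (z ,_) xs) xy∈
  ... | inj₁ xy∈zxs with ∈-map⁻ _ xy∈zxs
  ...   | _ , y∈ , refl = here refl , there y∈
  ∈-pairs⁻ (z ∷ xs) xy∈ | inj₂ xy∈pairs = Product.map there there (∈-pairs⁻ xs xy∈pairs)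

module StarClique {n} (E : Graph (suc n)) (v : Fin (suc n)) where

  del-≢ : ∀ {x} (v≢x : v ≢ x) → del v x ≡ just (punchOut v≢x)
  del-≢ {x} v≢x with v ≟ x
  ... | yes v≡x = ⊥-elim (v≢x v≡x)
  ... | no _    = cong just (punchOut-cong v refl)

  del-just : ∀ {x x′} → del v x ≡ just x′ → x ≡ punchIn v x′
  del-just {x} eq with v ≟ x
  del-just {x} refl | no v≢x = sym (punchIn-punchOut v≢x)

  keepEdge-≢ : ∀ {a b c} (v≢a : v ≢ a) (v≢b : v ≢ b) →
    keepEdge v (edge a b c) ≡ just (edge (punchOut v≢a) (punchOut v≢b) c)
  keepEdge-≢ v≢a v≢b rewrite del-≢ v≢a | del-≢ v≢b = refl

  keepEdge-just : ∀ {e e′} → keepEdge v e ≡ just e′ →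
    e ≡ edge (punchIn v (end₁ e′)) (punchIn v (end₂ e′)) (weight e′)
  keepEdge-just {edge a b c} eq with del v a in a≡ | del v b in b≡
  keepEdge-just {edge a b c} refl | just _ | just _ = cong₂ (λ x y → edge x y c) (del-just a≡) (del-just b≡)

  incident-≢ : ∀ {e x} → Joins e x v → v ≢ x → incident v e ≡ just (x , weight e)
  incident-≢ {edge a b c} (inj₁ (refl , refl)) v≢a with a ≟ v | v ≟ v
  ... | yes a≡v | _      = ⊥-elim (v≢a (sym a≡v))
  ... | no _    | yes _  = refl
  ... | no _    | no v≢v = ⊥-elim (v≢v refl)
  incident-≢ {edge a b c} (inj₂ (refl , refl)) _ with v ≟ v
  ... | yes _  = refl
  ... | no v≢v = ⊥-elim (v≢v refl)

  incident-just : ∀ {e x c} → incident v e ≡ just (x , c) → Joins e x v × weight e ≡ c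
  incident-just {edge a b c} eq with a ≟ v | b ≟ v
  incident-just {edge a b c} refl | yes a≡v | _       = inj₂ (a≡v , refl) , refl
  incident-just {edge a b c} refl | no _    | yes b≡v = inj₁ (refl , b≡v) , refl

  cliqueEdge-≢ : ∀ {x y a b} (v≢x : v ≢ x) (v≢y : v ≢ y) →
    cliqueEdge v ((x , a) , (y , b)) ≡ just (edge (punchOut v≢x) (punchOut v≢y) (gcd a b))
  cliqueEdge-≢ v≢x v≢y rewrite del-≢ v≢x | del-≢ v≢y = refl

  cliqueEdge-just : ∀ {x y a b e′} → cliqueEdge v ((x , a) , (y , b)) ≡ just e′ →
    x ≡ punchIn v (end₁ e′) × y ≡ punchIn v (end₂ e′) × weight e′ ≡ gcd a b
  cliqueEdge-just {x} {y} eq with del v x in x≡ | del v y in y≡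
  cliqueEdge-just refl | just _ | just _ = del-just x≡ , del-just y≡ , refl

  Neighbours : List (Fin (suc n) × ℕ)
  Neighbours = mapMaybe (incident v) E

  KeptEdges CliqueEdges : Graph n
  KeptEdges   = mapMaybe (keepEdge v) E
  CliqueEdges = mapMaybe (cliqueEdge v) (pairs Neighbours)

  module _ {d : ℕ} where

    keptEdge⁺ : ∀ {x y} → DivEdge E d x y → (v≢x : v ≢ x) (v≢y : v ≢ y) →
      DivEdge (starClique v E) d (punchOut v≢x) (punchOut v≢y)
    keptEdge⁺ (e , e∈ , j , d∣) = Joins-elim {P = P} {e = e} P-sym kept j
      where
      P : Rel (Fin (suc n)) 0ℓ
      P x y = (v≢x : v ≢ x) (v≢y : v ≢ y) → DivEdge (starClique v E) d (punchOut v≢x) (punchOut v≢y)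
      P-sym : Symmetric P
      P-sym p v≢y v≢x = DivEdge-sym (p v≢x v≢y)
      kept : P (end₁ e) (end₂ e)
      kept v≢a v≢b =
        _ , ∈-++⁺ˡ (∈-mapMaybe⁺ (keepEdge v) e∈ (keepEdge-≢ v≢a v≢b)) , inj₁ (refl , refl) , d∣

    cliqueEdge⁺ : ∀ {x y} → DivEdge E d x v → DivEdge E d v y → x ≢ y → (v≢x : v ≢ x) (v≢y : v ≢ y) →
      DivEdge (starClique v E) d (punchOut v≢x) (punchOut v≢y)
    cliqueEdge⁺ (e₁ , e₁∈ , j₁ , d∣₁) (e₂ , e₂∈ , j₂ , d∣₂) x≢y v≢x v≢y
      with ∈-pairs⁺ (∈-mapMaybe⁺ (incident v) e₁∈ (incident-≢ j₁ v≢x))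
                    (∈-mapMaybe⁺ (incident v) e₂∈ (incident-≢ (Joins-sym {e = e₂} j₂) v≢y))
                    (x≢y ∘ cong proj₁)
    ... | inj₁ xy∈ = _ , ∈-++⁺ʳ KeptEdges (∈-mapMaybe⁺ (cliqueEdge v) xy∈ (cliqueEdge-≢ v≢x v≢y)) ,
                     inj₁ (refl , refl) , gcd-greatest d∣₁ d∣₂
    ... | inj₂ yx∈ = _ , ∈-++⁺ʳ KeptEdges (∈-mapMaybe⁺ (cliqueEdge v) yx∈ (cliqueEdge-≢ v≢y v≢x)) ,
                     inj₂ (refl , refl) , gcd-greatest d∣₂ d∣₁

    keptEdge⁻ : ∀ {e′} → e′ ∈ KeptEdges → d ∣ weight e′ →
      DivEdge E d (punchIn v (end₁ e′)) (punchIn v (end₂ e′))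
    keptEdge⁻ e′∈ d∣ with ∈-mapMaybe⁻ (keepEdge v) E e′∈
    ... | e , e∈ , eq = _ , subst (_∈ E) (keepEdge-just eq) e∈ , inj₁ (refl , refl) , d∣

    neighbour⇒DivEdge : ∀ {x c} → (x , c) ∈ Neighbours → d ∣ c → DivEdge E d x v
    neighbour⇒DivEdge xc∈ d∣c with ∈-mapMaybe⁻ (incident v) E xc∈
    ... | e , e∈ , eq with incident-just eq
    ...   | j , refl = e , e∈ , j , d∣c

    cliqueEdge⁻ : ∀ {e′} → e′ ∈ CliqueEdges → d ∣ weight e′ →
      DivEdge E d (punchIn v (end₁ e′)) v × DivEdge E d (punchIn v (end₂ e′)) v
    cliqueEdge⁻ e′∈ d∣ with ∈-mapMaybe⁻ (cliqueEdge v) (pairs Neighbours) e′∈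
    ... | ((x , a) , (y , b)) , xy∈ , eq with cliqueEdge-just eq | ∈-pairs⁻ Neighbours xy∈
    ...   | refl , refl , w≡ | x∈ , y∈ =
      neighbour⇒DivEdge x∈ (∣-trans d∣gcd (gcd[m,n]∣m a b)) ,
      neighbour⇒DivEdge y∈ (∣-trans d∣gcd (gcd[m,n]∣n a b))
      where
      d∣gcd : d ∣ gcd a b
      d∣gcd = subst (d ∣_) w≡ d∣

    bridge : ∀ {x y} → DivEdge E d x v → DivEdge E d v y → (v≢x : v ≢ x) (v≢y : v ≢ y) →
      Star (DivEdge (starClique v E) d) (punchOut v≢x) (punchOut v≢y)
    bridge {x} {y} xv vy v≢x v≢y with x ≟ y
    ... | yes refl = subst (Star _ _) (punchOut-cong v refl) ε
    ... | no x≢y   = cliqueEdge⁺ xv vy x≢y v≢x v≢y ◅ ε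

    -- Each passage x → v → y through v becomes the clique edge x – y; a detour x → v → x is dropped.
    lowerWalk : ∀ {x u} → Star (DivEdge E d) x u → (v≢x : v ≢ x) (v≢u : v ≢ u) →
      Star (DivEdge (starClique v E) d) (punchOut v≢x) (punchOut v≢u)
    lowerWalkVia : ∀ {x u} → DivEdge E d x v → Star (DivEdge E d) v u → (v≢x : v ≢ x) (v≢u : v ≢ u) →
      Star (DivEdge (starClique v E) d) (punchOut v≢x) (punchOut v≢u)

    lowerWalk ε v≢x v≢u = subst (Star _ _) (punchOut-cong v refl) ε
    lowerWalk (_◅_ {j = y} xy s) v≢x v≢u with v ≟ y
    ... | yes refl = lowerWalkVia xy s v≢x v≢u
    ... | no v≢y   = keptEdge⁺ xy v≢x v≢y ◅ lowerWalk s v≢y v≢u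

    lowerWalkVia xv ε v≢x v≢v = ⊥-elim (v≢v refl)
    lowerWalkVia xv (_◅_ {j = y} vy s) v≢x v≢u with v ≟ y
    ... | yes refl = lowerWalkVia xv s v≢x v≢u
    ... | no v≢y   = bridge xv vy v≢x v≢y ◅◅ lowerWalk s v≢y v≢u

    raiseEdge : ∀ {x′ y′} → DivEdge (starClique v E) d x′ y′ →
      Star (DivEdge E d) (punchIn v x′) (punchIn v y′)
    raiseEdge (e′ , e′∈ , j , d∣) with ∈-++⁻ KeptEdges e′∈
    ... | inj₁ kept =
      Joins-elim {P = λ x y → DivEdge E d (punchIn v x) (punchIn v y)} {e = e′} DivEdge-sym (keptEdge⁻ kept d∣) j ◅ ε
    ... | inj₂ clique =
      let xv , yv = Joins-elim {P = λ x y → DivEdge E d (punchIn v x) v × DivEdge E d (punchIn v y) v} {e = e′}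
                               Product.swap (cliqueEdge⁻ clique d∣) j
      in xv ◅ DivEdge-sym yv ◅ ε

    raiseWalk : ∀ {x′ u′} → Star (DivEdge (starClique v E) d) x′ u′ →
      Star (DivEdge E d) (punchIn v x′) (punchIn v u′)
    raiseWalk = kleisliStar (punchIn v) raiseEdge

lemma5p1 : ∀ {n : ℕ} (E : Graph (suc n)) → Loopless E → PositiveWeights E → Simple E →
    (v w u : Fin (suc n)) (w≢u : w ≢ u) (v≢w : v ≢ w) (v≢u : v ≢ u) →
    ∀ (m : ℕ) →
      (IsPathLcm E w u m → IsPathLcm (starClique v E) (punchOut v≢w) (punchOut v≢u) m) ×
      (IsPathLcm (starClique v E) (punchOut v≢w) (punchOut v≢u) m → IsPathLcm E w u m)
lemma5p1 E _ _ _ v w u _ v≢w v≢u m = IsPathLcm-transfer lower raise , IsPathLcm-transfer raise lower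
  where
  open StarClique E v
  lower : ∀ (p : Path E w u) → Σ[ q ∈ Path (starClique v E) _ _ ] pathGcd p ∣ pathGcd q
  lower p = walk⇒path (lowerWalk (path⇒walk p) v≢w v≢u)
  raise : ∀ (q : Path (starClique v E) (punchOut v≢w) (punchOut v≢u)) → Σ[ p ∈ Path E w u ] pathGcd q ∣ pathGcd p
  raise q = walk⇒path (subst₂ (Star _) (punchIn-punchOut v≢w) (punchIn-punchOut v≢u) (raiseWalk (path⇒walk q)))
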